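{- Let $\lambda$ be a positive integer and $\mu\ge0$. If $G$ is a bipartite graph satisfying the $(\lambda,\mu)$-bow metric, then its line graph $L(G)$ satisfies the $(\lambda-1,\mu+2)$-bow metric.
   Context: Graphs are finite, simple, unweighted, undirected, connected, with shortest-path distance $d$. The line graph $L(G)$ has the edges of $G$ as vertices, two being adjacent iff they share an endpoint. The interval is $I(u,v)=\{z: d(u,z)+d(z,v)=d(u,v)\}$. A graph satisfies the $(\lambda,\mu)$-bow metric if for all vertices $u,v,w,x$ with $v\in I(u,w)$, $w\in I(v,x)$ and $d(v,w)>\lambda$, one has $d(u,x)\ge d(u,v)+d(v,w)+d(w,x)-\mu$. -}

module Defs where

open import Data.Nat using (ℕ; zero; suc; _+_; _≤_; _<_)
open import Data.Fin using (Fin)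
import Data.Fin as F
open import Data.Bool using (Bool; true; false)
open import Data.Product using (Σ; ∃; _×_; _,_; proj₁; proj₂)
open import Data.Sum using (_⊎_)
open import Relation.Binary.PropositionalEquality using (_≡_; _≢_)
open import Relation.Nullary using (¬_)

record Graph : Set where
  field
    n      : ℕ
    E      : Fin n → Fin n → Bool
    sym    : ∀ i j → E i j ≡ E j i
    irrefl : ∀ i → E i i ≡ false

data Walk {V : Set} (Adj : V → V → Set) : V → V → ℕ → Set where
  here : ∀ {u} → Walk Adj u u zero
  step : ∀ {u v w k} → Adj u v → Walk Adj v w k → Walk Adj u w (suc k)

Dist : {V : Set} (Adj : V → V → Set) → V → V → ℕ → Set
Dist Adj u v k = Walk Adj u v k × (∀ m → Walk Adj u v m → k ≤ m)

-- With v ∈ I(u,w) meaning d(u,v)+d(v,w) = d(u,w):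
-- for all u v w x with v ∈ I(u,w), w ∈ I(v,x), d(v,w) > l,
--   d(u,x) ≥ d(u,v) + d(v,w) + d(w,x) - μ   (stated as  ... ≤ d(u,x) + μ).
BowMetric : {V : Set} (Adj : V → V → Set) (l μ : ℕ) → Set
BowMetric {V} Adj l μ =
  ∀ (u v w x : V) (duv dvw dwx duw dvx dux : ℕ) →
  Dist Adj u v duv → Dist Adj v w dvw → Dist Adj w x dwx →
  Dist Adj u w duw → Dist Adj v x dvx → Dist Adj u x dux →
  duw ≡ duv + dvw →
  dvx ≡ dvw + dwx →
  l < dvw →
  duv + dvw + dwx ≤ dux + μ

module _ (G : Graph) where
  open Graph G

  Adj : Fin n → Fin n → Set
  Adj i j = E i j ≡ true

  Connected : Set
  Connected = ∀ u v → ∃ λ k → Walk Adj u v k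

  Bipartite : Set
  Bipartite = Σ (Fin n → Bool) λ c → ∀ i j → Adj i j → c i ≢ c j

  -- Vertices of the line graph: edges {i,j} of G, represented with i < j.
  LVertex : Set
  LVertex = Σ (Fin n) λ i → Σ (Fin n) λ j → (i F.< j) × Adj i j

  LAdj : LVertex → LVertex → Set
  LAdj (a , b , _) (c , d , _) =
    ¬ (a ≡ c × b ≡ d) × (a ≡ c ⊎ a ≡ d ⊎ b ≡ c ⊎ b ≡ d)

{-# OPTIONS --safe #-}
module Submission where

-- Write d and d_L for the distances in G and L(G).  For edges e, f with
-- d_L(e,f) = K ≥ 1 the closest endpoints are at distance K - 1 and all
-- endpoints at distance ≤ K + 1.  Given a bow E₁ E₂ E₃ E₄ in L(G) with line
-- distances a + 1, b + 1, c + 1, pick closest endpoints u ∈ E₁, p ∈ E₂ and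
-- q ∈ E₃, x ∈ E₄.  The interval conditions of the bow put every endpoint of E₃
-- at distance > b from p and every endpoint of E₂ at distance > b from q,
-- while some endpoints of E₂ and E₃ are at distance b; since in a bipartite
-- graph all walks between two vertices have lengths of equal parity, this
-- forces d(p,q) = b + 2 and makes u p q x a bow in G.  Its inequality plus
-- d(u,x) ≤ d_L(E₁,E₄) + 1 gives the claim.

open import Defs
open import Data.Nat using (ℕ; zero; suc; _≤_; _∸_; _+_; z≤n; s≤s; parity)
open import Data.Nat.Properties
open import Data.Nat.Tactic.RingSolver using (solve)
open import Data.List using (_∷_; [])
open import Data.Parity using (Parity; 0ℙ; 1ℙ; _⁻¹) renaming (_+_ to _+ℙ_)
import Data.Parity.Properties as ℙ
open import Data.Fin using (Fin)
import Data.Fin as F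
import Data.Fin.Properties as FP
open import Data.Bool using (Bool; true; false)
import Data.Bool as B
open import Data.Product
open import Data.Sum
open import Data.Empty
open import Relation.Nullary
open import Relation.Nullary.Decidable using (_×-dec_)
open import Relation.Binary.PropositionalEquality
open import Relation.Binary.Construct.Closure.Reflexive as Refl using (ReflClosure; [_])
open import Relation.Binary.Definitions using (tri<; tri≈; tri>)
open import Axiom.UniquenessOfIdentityProofs using (module Decidable⇒UIP)

least-witness : {P : ℕ → Set} → (∀ k → Dec (P k)) →
                ∀ {m} → P m → ∃ λ k → P k × (∀ j → P j → k ≤ j)
least-witness {P} P? {m} pm = search m 0 (+-identityʳ m) (λ _ _ → z≤n)
  where
  search : ∀ r N → r + N ≡ m → (∀ j → P j → N ≤ j) → ∃ λ k → P k × (∀ j → P j → k ≤ j)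
  search r N r+N≡m below with P? N
  ... | yes pN = N , pN , below
  search zero N refl below | no ¬pN = ⊥-elim (¬pN pm)
  search (suc r) N r+N≡m below | no ¬pN =
    search r (suc N) (trans (+-suc r N) r+N≡m)
      (λ j pj → ≤∧≢⇒< (below j pj) (λ { refl → ¬pN pj }))

parity-suc : ∀ k → parity (suc k) ≡ parity k ⁻¹
parity-suc k = sym (ℙ.⁻¹-selfInverse (ℙ.suc-homo-⁻¹ k))

≤-suc-parity⇒≡ : ∀ {m n} → m ≤ n → n ≤ suc m → parity m ≡ parity n → m ≡ n
≤-suc-parity⇒≡ {m} m≤n n≤1+m same with m≤n⇒m<n∨m≡n m≤n
... | inj₂ m≡n = m≡n
... | inj₁ m<n with ≤-antisym n≤1+m m<n
...   | refl = ⊥-elim (ℙ.p≢p⁻¹ (parity m) (trans same (parity-suc m)))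

module _ {V : Set} {R : V → V → Set} where

  infixr 5 _◅◅_
  _◅◅_ : ∀ {x y z k m} → Walk R x y k → Walk R y z m → Walk R x z (k + m)
  here     ◅◅ w′ = w′
  step r w ◅◅ w′ = step r (w ◅◅ w′)

  _▷_ : ∀ {x y z k} → Walk R x y k → R y z → Walk R x z (suc k)
  here     ▷ r′ = step r′ here
  step r w ▷ r′ = step r (w ▷ r′)

  walk₀⇒≡ : ∀ {x y} → Walk R x y 0 → x ≡ y
  walk₀⇒≡ here = refl

  Dist-refl : ∀ {x} → Dist R x x 0
  Dist-refl = here , λ _ _ → z≤n

  Dist-≤ : ∀ {x y k m} → Dist R x y k → Walk R x y m → k ≤ m
  Dist-≤ dist w = proj₂ dist _ w

  Dist-unique : ∀ {x y k k′} → Dist R x y k → Dist R x y k′ → k ≡ k′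
  Dist-unique dist dist′ = ≤-antisym (Dist-≤ dist (proj₁ dist′)) (Dist-≤ dist′ (proj₁ dist))

  Dist-triangle : ∀ {x y z k m n} → Dist R x y k → Dist R y z m → Dist R x z n → n ≤ k + m
  Dist-triangle dxy dyz dxz = Dist-≤ dxz (proj₁ dxy ◅◅ proj₁ dyz)

  Dist-stepˡ : ∀ {x y z k k′} → ReflClosure R x y → Dist R y z k → Dist R x z k′ → k′ ≤ suc k
  Dist-stepˡ Refl.refl dyz dxz = ≤-trans (Dist-≤ dxz (proj₁ dyz)) (n≤1+n _)
  Dist-stepˡ [ r ]     dyz dxz = Dist-≤ dxz (step r (proj₁ dyz))

  Dist-stepʳ : ∀ {x y z k k′} → ReflClosure R y z → Dist R x y k → Dist R x z k′ → k′ ≤ suc k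
  Dist-stepʳ Refl.refl dxy dxz = ≤-trans (Dist-≤ dxz (proj₁ dxy)) (n≤1+n _)
  Dist-stepʳ [ r ]     dxy dxz = Dist-≤ dxz (proj₁ dxy ▷ r)

  bow-degenerateˡ : ∀ {u v x dvw dwx dvx dux} μ → Dist R u v 0 → Dist R v x dvx →
                    Dist R u x dux → dvx ≡ dvw + dwx → 0 + dvw + dwx ≤ dux + μ
  bow-degenerateˡ μ duv dvx dux dvx≡ with walk₀⇒≡ (proj₁ duv)
  ... | refl = ≤-trans (≤-reflexive (trans (sym dvx≡) (Dist-unique dvx dux))) (m≤m+n _ μ)

  bow-degenerateʳ : ∀ {u w x duv dvw duw dux} μ → Dist R w x 0 → Dist R u w duw →
                    Dist R u x dux → duw ≡ duv + dvw → duv + dvw + 0 ≤ dux + μ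
  bow-degenerateʳ μ dwx duw dux duw≡ with walk₀⇒≡ (proj₁ dwx)
  ... | refl = ≤-trans (≤-reflexive (trans (+-identityʳ _) (trans (sym duw≡) (Dist-unique duw dux))))
                       (m≤m+n _ μ)

Walk≤ : {V : Set} (R : V → V → Set) → V → V → ℕ → Set
Walk≤ R x y k = ∃ λ m → m ≤ k × Walk R x y m

Walk≤-prepend : ∀ {V : Set} {R : V → V → Set} {x y z k} →
                ReflClosure R x y → Walk≤ R y z k → Walk≤ R x z (suc k)
Walk≤-prepend Refl.refl (m , m≤k , w) = m , ≤-trans m≤k (n≤1+n _) , w
Walk≤-prepend [ r ]     (m , m≤k , w) = suc m , s≤s m≤k , step r w

module _ {n : ℕ} {R : Fin n → Fin n → Set} (R? : ∀ x y → Dec (R x y)) where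

  walk? : ∀ k x y → Dec (Walk R x y k)
  walk? zero x y with x F.≟ y
  ... | yes refl = yes here
  ... | no x≢y   = no λ { here → x≢y refl }
  walk? (suc k) x y with FP.any? (λ z → R? x z ×-dec walk? k z y)
  ... | yes (z , r , w) = yes (step r w)
  ... | no ∄z           = no λ { (step r w) → ∄z (_ , r , w) }

  Dist-exists : ∀ {x y k} → Walk R x y k → ∃ (Dist R x y)
  Dist-exists {x} {y} = least-witness (λ k → walk? k x y)

module TwoColoured {V : Set} {R : V → V → Set} (colour : V → Bool)
                   (proper : ∀ x y → R x y → colour x ≢ colour y) where

  private
    ⟦_⟧ : Bool → Parity
    ⟦ false ⟧ = 0ℙ
    ⟦ true  ⟧ = 1ℙ

    ⟦⟧-≢ : ∀ {b b′} → b ≢ b′ → ⟦ b′ ⟧ ≡ ⟦ b ⟧ ⁻¹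
    ⟦⟧-≢ {false} {false} b≢b′ = ⊥-elim (b≢b′ refl)
    ⟦⟧-≢ {false} {true}  _    = refl
    ⟦⟧-≢ {true}  {false} _    = refl
    ⟦⟧-≢ {true}  {true}  b≢b′ = ⊥-elim (b≢b′ refl)

    ⁻¹-+-⁻¹ : ∀ p q → (p ⁻¹ +ℙ q) ⁻¹ ≡ p +ℙ q
    ⁻¹-+-⁻¹ 0ℙ 0ℙ = refl
    ⁻¹-+-⁻¹ 0ℙ 1ℙ = refl
    ⁻¹-+-⁻¹ 1ℙ 0ℙ = refl
    ⁻¹-+-⁻¹ 1ℙ 1ℙ = refl

    walk-parity : ∀ {x y k} → Walk R x y k → parity k ≡ ⟦ colour x ⟧ +ℙ ⟦ colour y ⟧
    walk-parity {x} here = sym (ℙ.p+p≡0ℙ ⟦ colour x ⟧)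
    walk-parity {x} {y} (step {v = z} {k = k} r w) = begin
      parity (suc k)                           ≡⟨ parity-suc k ⟩
      parity k ⁻¹                              ≡⟨ cong _⁻¹ (walk-parity w) ⟩
      (⟦ colour z ⟧ +ℙ ⟦ colour y ⟧) ⁻¹        ≡⟨ cong (λ c → (c +ℙ ⟦ colour y ⟧) ⁻¹) (⟦⟧-≢ (proper x z r)) ⟩
      (⟦ colour x ⟧ ⁻¹ +ℙ ⟦ colour y ⟧) ⁻¹     ≡⟨ ⁻¹-+-⁻¹ ⟦ colour x ⟧ ⟦ colour y ⟧ ⟩
      ⟦ colour x ⟧ +ℙ ⟦ colour y ⟧             ∎
      where open ≡-Reasoning

  walks-same-parity : ∀ {x y k k′} → Walk R x y k → Walk R x y k′ → parity k ≡ parity k′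
  walks-same-parity w w′ = trans (walk-parity w) (sym (walk-parity w′))

module LineGraph (G : Graph) (connected : Connected G) where
  open Graph G renaming (sym to E-sym)

  Adj-sym : ∀ {x y} → Adj G x y → Adj G y x
  Adj-sym {x} {y} xy = trans (E-sym y x) xy

  Adj? : ∀ x y → Dec (Adj G x y)
  Adj? x y = E x y B.≟ true

  d : Fin n → Fin n → ℕ
  d x y = proj₁ (Dist-exists Adj? (proj₂ (connected x y)))

  d-Dist : ∀ x y → Dist (Adj G) x y (d x y)
  d-Dist x y = proj₂ (Dist-exists Adj? (proj₂ (connected x y)))

  d-walk : ∀ x y → Walk (Adj G) x y (d x y)
  d-walk x y = proj₁ (d-Dist x y)

  d-triangle : ∀ x y z → d x z ≤ d x y + d y z
  d-triangle x y z = Dist-triangle (d-Dist x y) (d-Dist y z) (d-Dist x z)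

  _∈ₑ_ : Fin n → LVertex G → Set
  x ∈ₑ (a , b , _) = x ≡ a ⊎ x ≡ b

  endpoints-close : ∀ {x y} e → x ∈ₑ e → y ∈ₑ e → ReflClosure (Adj G) x y
  endpoints-close e                  (inj₁ refl) (inj₁ refl) = Refl.refl
  endpoints-close (a , b , _ , ab) (inj₁ refl) (inj₂ refl) = [ ab ]
  endpoints-close (a , b , _ , ab) (inj₂ refl) (inj₁ refl) = [ Adj-sym ab ]
  endpoints-close e                  (inj₂ refl) (inj₂ refl) = Refl.refl

  LVertex-≡ : ∀ {a b c e} {p : (a F.< b) × Adj G a b} {q : (c F.< e) × Adj G c e} →
              a ≡ c → b ≡ e → _≡_ {A = LVertex G} (a , b , p) (c , e , q)
  LVertex-≡ {p = a<b , ab} {c<e , ce} refl refl =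
    cong (λ r → _ , _ , r)
      (cong₂ _,_ (FP.<-irrelevant a<b c<e) (Decidable⇒UIP.≡-irrelevant B._≟_ ab ce))

  endpoints-match : ∀ {x a b c e : Fin n} → x ≡ a ⊎ x ≡ b → x ≡ c ⊎ x ≡ e →
                    a ≡ c ⊎ a ≡ e ⊎ b ≡ c ⊎ b ≡ e
  endpoints-match (inj₁ refl) (inj₁ refl) = inj₁ refl
  endpoints-match (inj₁ refl) (inj₂ refl) = inj₂ (inj₁ refl)
  endpoints-match (inj₂ refl) (inj₁ refl) = inj₂ (inj₂ (inj₁ refl))
  endpoints-match (inj₂ refl) (inj₂ refl) = inj₂ (inj₂ (inj₂ refl))

  common-endpoint⇒close : ∀ {x} e f → x ∈ₑ e → x ∈ₑ f → ReflClosure (LAdj G) e f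
  common-endpoint⇒close (a , b , p) (c , e , q) x∈e x∈f with a F.≟ c | b F.≟ e
  ... | yes a≡c | yes b≡e = subst (ReflClosure (LAdj G) _) (LVertex-≡ a≡c b≡e) Refl.refl
  ... | no a≢c  | _       = [ ((λ z → a≢c (proj₁ z)) , endpoints-match x∈e x∈f) ]
  ... | yes _   | no b≢e  = [ ((λ z → b≢e (proj₂ z)) , endpoints-match x∈e x∈f) ]

  LAdj⇒common-endpoint : ∀ e f → LAdj G e f → ∃ λ x → x ∈ₑ e × x ∈ₑ f
  LAdj⇒common-endpoint (a , _) _ (_ , inj₁ refl)                 = a , inj₁ refl , inj₁ refl
  LAdj⇒common-endpoint (a , _) _ (_ , inj₂ (inj₁ refl))          = a , inj₁ refl , inj₂ refl
  LAdj⇒common-endpoint (_ , b , _) _ (_ , inj₂ (inj₂ (inj₁ refl))) = b , inj₂ refl , inj₁ refl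
  LAdj⇒common-endpoint (_ , b , _) _ (_ , inj₂ (inj₂ (inj₂ refl))) = b , inj₂ refl , inj₂ refl

  edge-vertex : ∀ {x y} → Adj G x y → Σ (LVertex G) λ e → x ∈ₑ e × y ∈ₑ e
  edge-vertex {x} {y} xy with FP.<-cmp x y
  ... | tri< x<y _ _    = (x , y , x<y , xy) , inj₁ refl , inj₂ refl
  ... | tri≈ _ refl _ with () ← trans (sym xy) (irrefl x)
  ... | tri> _ _ y<x    = (y , x , y<x , Adj-sym xy) , inj₂ refl , inj₁ refl

  walk⇒lineWalk≤ : ∀ {x y k} e f → Walk (Adj G) x y k → x ∈ₑ e → y ∈ₑ f → Walk≤ (LAdj G) e f (suc k)
  walk⇒lineWalk≤ e f here x∈e x∈f = Walk≤-prepend (common-endpoint⇒close e f x∈e x∈f) (0 , z≤n , here)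
  walk⇒lineWalk≤ e f (step xz w) x∈e y∈f with edge-vertex xz
  ... | g , x∈g , z∈g = Walk≤-prepend (common-endpoint⇒close e g x∈e x∈g) (walk⇒lineWalk≤ g f w z∈g y∈f)

  lineDist≤dist+1 : ∀ {e f K x y} → Dist (LAdj G) e f K → x ∈ₑ e → y ∈ₑ f → K ≤ suc (d x y)
  lineDist≤dist+1 {e} {f} {x = x} {y} dL x∈e y∈f with walk⇒lineWalk≤ e f (d-walk x y) x∈e y∈f
  ... | m , m≤ , w = ≤-trans (Dist-≤ dL w) m≤

  lineWalk⇒close-endpoints : ∀ {e f K} → Walk (LAdj G) e f (suc K) →
                             ∃₂ λ x y → x ∈ₑ e × y ∈ₑ f × d x y ≤ K
  lineWalk⇒close-endpoints {e} {f} {zero} (step ef here) with LAdj⇒common-endpoint e f ef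
  ... | x , x∈e , x∈f = x , x , x∈e , x∈f , ≤-reflexive (Dist-unique (d-Dist x x) Dist-refl)
  lineWalk⇒close-endpoints {e} {f} {suc K} (step {v = g} eg w) with LAdj⇒common-endpoint e g eg | lineWalk⇒close-endpoints w
  ... | x , x∈e , x∈g | x′ , y , x′∈g , y∈f , dx′y≤K =
    x , y , x∈e , y∈f , ≤-trans (Dist-stepˡ (endpoints-close g x∈g x′∈g) (d-Dist x′ y) (d-Dist x y)) (s≤s dx′y≤K)

  dist≤lineDist+1 : ∀ {e f K x y} → Dist (LAdj G) e f K → x ∈ₑ e → y ∈ₑ f → d x y ≤ suc K
  dist≤lineDist+1 {e} {f} {zero} {x} {y} dL x∈e y∈f with walk₀⇒≡ (proj₁ dL)
  ... | refl = Dist-stepˡ (endpoints-close e x∈e y∈f) Dist-refl (d-Dist x y)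
  dist≤lineDist+1 {e} {f} {suc K} {x} {y} dL x∈e y∈f with lineWalk⇒close-endpoints (proj₁ dL)
  ... | x′ , y′ , x′∈e , y′∈f , dx′y′≤K = begin
    d x y        ≤⟨ Dist-stepˡ (endpoints-close e x∈e x′∈e) (d-Dist x′ y) (d-Dist x y) ⟩
    suc (d x′ y) ≤⟨ s≤s (Dist-stepʳ (endpoints-close f y′∈f y∈f) (d-Dist x′ y′) (d-Dist x′ y)) ⟩
    suc (suc (d x′ y′)) ≤⟨ s≤s (s≤s dx′y′≤K) ⟩
    suc (suc K)  ∎
    where open ≤-Reasoning

  closest-endpoints : ∀ {e f K} → Dist (LAdj G) e f (suc K) →
                      ∃₂ λ x y → x ∈ₑ e × y ∈ₑ f × d x y ≡ K
  closest-endpoints dL with lineWalk⇒close-endpoints (proj₁ dL)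
  ... | x , y , x∈e , y∈f , dxy≤K =
    x , y , x∈e , y∈f , ≤-antisym dxy≤K (≤-pred (lineDist≤dist+1 dL x∈e y∈f))

module LineGraphBow (G : Graph) (connected : Connected G) (bipartite : Bipartite G)
                    (l μ : ℕ) (bow : BowMetric (Adj G) l μ) where
  open LineGraph G connected
  open TwoColoured (proj₁ bipartite) (proj₂ bipartite)

  walk≤dist+1⇒geodesic : ∀ {x y m} → Walk (Adj G) x y m → m ≤ suc (d x y) → d x y ≡ m
  walk≤dist+1⇒geodesic {x} {y} w m≤1+d =
    ≤-suc-parity⇒≡ (Dist-≤ (d-Dist x y) w) m≤1+d (walks-same-parity (d-walk x y) w)

  detour≤1⇒geodesic : ∀ x y z → d x y + d y z ≤ suc (d x z) → d x z ≡ d x y + d y z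
  detour≤1⇒geodesic x y z = walk≤dist+1⇒geodesic (d-walk x y ◅◅ d-walk y z)

  bow-nondegenerate : ∀ {E₁ E₂ E₃ E₄ a b c dux} →
    Dist (LAdj G) E₁ E₂ (suc a) → Dist (LAdj G) E₂ E₃ (suc b) → Dist (LAdj G) E₃ E₄ (suc c) →
    Dist (LAdj G) E₁ E₃ (suc a + suc b) → Dist (LAdj G) E₂ E₄ (suc b + suc c) →
    Dist (LAdj G) E₁ E₄ dux → l ≤ suc b →
    suc a + suc b + suc c ≤ dux + (μ + 2)
  bow-nondegenerate {E₂ = E₂} {E₃} {a = a} {b} {c} {dux} D₁₂ D₂₃ D₃₄ D₁₃ D₂₄ D₁₄ l≤1+b
    with closest-endpoints D₁₂ | closest-endpoints D₂₃ | closest-endpoints D₃₄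
  ... | u , p , u∈E₁ , p∈E₂ , dup≡a | p′ , q′ , p′∈E₂ , q′∈E₃ , dp′q′≡b
      | q , x , q∈E₃ , x∈E₄ , dqx≡c = begin
    suc a + suc b + suc c          ≡⟨ solve (a ∷ b ∷ c ∷ []) ⟩
    suc (a + suc (suc b) + c)      ≡⟨ cong suc (sym (cong₂ _+_ (cong₂ _+_ dup≡a dpq≡2+b) dqx≡c)) ⟩
    suc (d u p + d p q + d q x)    ≤⟨ s≤s bow-in-G ⟩
    suc (d u x + μ)                ≤⟨ s≤s (+-monoˡ-≤ μ (dist≤lineDist+1 D₁₄ u∈E₁ x∈E₄)) ⟩
    suc (suc dux + μ)              ≡⟨ solve (dux ∷ μ ∷ []) ⟩
    dux + (μ + 2)                  ∎
    where
    open ≤-Reasoning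

    E₃-far-from-p : ∀ {w} → w ∈ₑ E₃ → suc b ≤ d p w
    E₃-far-from-p {w} w∈E₃ = +-cancelˡ-≤ (suc a) _ _ (begin
      suc a + suc b         ≤⟨ lineDist≤dist+1 D₁₃ u∈E₁ w∈E₃ ⟩
      suc (d u w)           ≤⟨ s≤s (d-triangle u p w) ⟩
      suc (d u p + d p w)   ≡⟨ cong (λ k → suc (k + d p w)) dup≡a ⟩
      suc a + d p w         ∎)

    E₂-far-from-q : ∀ {z} → z ∈ₑ E₂ → suc b ≤ d z q
    E₂-far-from-q {z} z∈E₂ = +-cancelʳ-≤ (suc c) _ _ (begin
      suc b + suc c         ≤⟨ lineDist≤dist+1 D₂₄ z∈E₂ x∈E₄ ⟩
      suc (d z x)           ≤⟨ s≤s (d-triangle z q x) ⟩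
      suc (d z q + d q x)   ≡⟨ cong (λ k → suc (d z q + k)) dqx≡c ⟩
      suc (d z q + c)       ≡⟨ sym (+-suc (d z q) c) ⟩
      d z q + suc c         ∎)

    dpq≡2+b : d p q ≡ suc (suc b)
    dpq≡2+b with endpoints-close E₂ p∈E₂ p′∈E₂ | endpoints-close E₃ q′∈E₃ q∈E₃
    ... | Refl.refl | _ = ⊥-elim (<-irrefl (sym dp′q′≡b) (E₃-far-from-p q′∈E₃))
    ... | [ _ ] | Refl.refl = ⊥-elim (<-irrefl (sym dp′q′≡b) (E₂-far-from-q p′∈E₂))
    ... | [ pp′ ] | [ q′q ] =
      walk≤dist+1⇒geodesic (step pp′ (subst (Walk _ p′ q′) dp′q′≡b (d-walk p′ q′) ▷ q′q))
                           (s≤s (E₃-far-from-p q∈E₃))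

    upq-geodesic : d u q ≡ d u p + d p q
    upq-geodesic = detour≤1⇒geodesic u p q (begin
      d u p + d p q              ≡⟨ cong₂ _+_ dup≡a dpq≡2+b ⟩
      a + suc (suc b)            ≡⟨ +-suc a (suc b) ⟩
      suc a + suc b              ≤⟨ lineDist≤dist+1 D₁₃ u∈E₁ q∈E₃ ⟩
      suc (d u q)                ∎)

    pqx-geodesic : d p x ≡ d p q + d q x
    pqx-geodesic = detour≤1⇒geodesic p q x (begin
      d p q + d q x              ≡⟨ cong₂ _+_ dpq≡2+b dqx≡c ⟩
      suc (suc b + c)            ≡⟨ cong suc (sym (+-suc b c)) ⟩
      suc (b + suc c)            ≤⟨ lineDist≤dist+1 D₂₄ p∈E₂ x∈E₄ ⟩
      suc (d p x)                ∎)

    bow-in-G : d u p + d p q + d q x ≤ d u x + μ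
    bow-in-G = bow u p q x _ _ _ _ _ _ (d-Dist u p) (d-Dist p q) (d-Dist q x)
                 (d-Dist u q) (d-Dist p x) (d-Dist u x) upq-geodesic pqx-geodesic
                 (≤-trans (s≤s l≤1+b) (≤-reflexive (sym dpq≡2+b)))

  bow-metric : BowMetric (LAdj G) (l ∸ 1) (μ + 2)
  bow-metric _ _ _ _ zero dvw dwx _ _ _ D₁₂ _ _ _ D₂₄ D₁₄ _ dvx≡ _ =
    bow-degenerateˡ {dvw = dvw} {dwx} (μ + 2) D₁₂ D₂₄ D₁₄ dvx≡
  bow-metric _ _ _ _ (suc _) zero _ _ _ _ _ _ _ _ _ _ _ _ ()
  bow-metric _ _ _ _ duv@(suc _) dvw@(suc _) zero _ _ _ _ _ D₃₄ D₁₃ _ D₁₄ duw≡ _ _ =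
    bow-degenerateʳ {duv = duv} {dvw} (μ + 2) D₃₄ D₁₃ D₁₄ duw≡
  bow-metric _ _ _ _ (suc a) (suc b) (suc c) _ _ _ D₁₂ D₂₃ D₃₄ D₁₃ D₂₄ D₁₄ refl refl l∸1<1+b =
    bow-nondegenerate D₁₂ D₂₃ D₃₄ D₁₃ D₂₄ D₁₄ (≤-trans (m≤n+m∸n l 1) l∸1<1+b)

lemma9 : (G : Graph) (l μ : ℕ) → 1 ≤ l →
    Connected G → Bipartite G → BowMetric (Adj G) l μ →
    BowMetric (LAdj G) (l ∸ 1) (μ + 2)
lemma9 G l μ _ connected bipartite bow = LineGraphBow.bow-metric G connected bipartite l μ bow
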